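{- Consider an instance of the market clearing prices problem with $n$ items and $n$ buyers and valuations $v_{b,i}$. Let $M=\{M_1,\dots,M_k\}$ be any set of $k$ market clearing price vectors for this instance. For $j\in\{1,\dots,k\}$, define the price vector $p^j$ by letting, for every item $m$, $p^j[m]$ be the $j$-th element of the multiset $\{M_i[m]: 1\le i\le k\}$ sorted in nondecreasing order. Then $p^j$ is a market clearing price vector.
   Context: In the market clearing prices problem (as in Easley and Kleinberg, "Networks, Crowds, and Markets") there are $n$ items, each offered by a seller, and $n$ buyers; buyer $b$ values item $i$ at $v_{b,i}$. A price vector $p$ assigns a price $p[i]$ to each item $i$. Given $p$, the payoff of buyer $b$ for item $i$ is $v_{b,i}-p[i]$, and the preferred items of $b$ are those maximizing this payoff. The preferred-seller graph is the bipartite graph joining each buyer to each of its preferred items. A price vector $p$ is market clearing if its preferred-seller graph has a perfect matching (each buyer is assigned a distinct item that is among its preferred items).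
   Formalization: The valuations $v_{b,i}$ and the prices of the given market clearing vectors $M_i$ are rational, so the vectors $p^j$ have rational entries as well. -}

module Defs where

open import Data.Nat using (ℕ)
open import Data.Fin using (Fin; cast)
open import Data.Rational using (ℚ; _-_; _≤_)
open import Data.Rational.Properties using (≤-decTotalOrder)
open import Data.List using (List; tabulate; length; lookup)
open import Data.List.Properties using (length-tabulate)
open import Data.List.Relation.Binary.Permutation.Propositional.Properties using (↭-length)
open import Data.Product using (Σ; _×_)
open import Function.Definitions using (Injective)
open import Relation.Binary.PropositionalEquality using (_≡_; trans; sym)
import Data.List.Sort as Sort
open Sort ≤-decTotalOrder using (sort; sort-↭)

-- Valuations: v b i is the value buyer b assigns to item i (n buyers, n items).
Valuation : ℕ → Set
Valuation n = Fin n → Fin n → ℚ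

PriceVector : ℕ → Set
PriceVector n = Fin n → ℚ

payoff : ∀ {n} → Valuation n → PriceVector n → Fin n → Fin n → ℚ
payoff v p b i = v b i - p i

Preferred : ∀ {n} → Valuation n → PriceVector n → Fin n → Fin n → Set
Preferred v p b i = ∀ i′ → payoff v p b i′ ≤ payoff v p b i

-- The preferred-seller graph has a perfect matching: each buyer b is
-- assigned a distinct item σ b which is among its preferred items.
MarketClearing : ∀ {n} → Valuation n → PriceVector n → Set
MarketClearing {n} v p =
  Σ (Fin n → Fin n) λ σ → Injective _≡_ _≡_ σ × (∀ b → Preferred v p b (σ b))

-- The j-th element (0-indexed j : Fin k) of the values f 0, ..., f (k-1)
-- sorted in nondecreasing order.
sorted-length : ∀ {k} (f : Fin k → ℚ) → length (sort (tabulate f)) ≡ k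
sorted-length f = trans (↭-length (sort-↭ (tabulate f))) (length-tabulate f)

orderStat : ∀ {k} → (Fin k → ℚ) → Fin k → ℚ
orderStat f j = lookup (sort (tabulate f)) (cast (sym (sorted-length f)) j)

pj : ∀ {n k} → (Fin k → PriceVector n) → Fin k → PriceVector n
pj M j m = orderStat (λ i → M i m) j

-- Market-clearing price vectors are closed under pointwise min and max.  Given
-- matchings σ for p and τ for q, let each buyer take its σ-item if p pays it at
-- least as much as q, and its τ-item otherwise.  A σ-item so taken is no dearer
-- under p than under q, a τ-item so taken is strictly dearer, so the choices never
-- collide: this is a matching for the min.  Being an injection of a finite set it
-- is onto, which forces the opposite choice (the item of the vector paying less)
-- to obey the same price dichotomy, and that makes it a matching for the max.
-- The order statistics p^j arise from the M_i by insertion sort with min and max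
-- as compare-exchange, run on whole price vectors: coordinatewise this is ordinary
-- insertion sort, and every vector it produces is a meet or join of clearing ones.
module Submission where

open import Defs
open import Data.Nat using (ℕ; suc)
import Data.Nat.Properties as ℕ
open import Data.Fin using (Fin; zero; suc; cast; punchOut; _≟_)
open import Data.Fin.Properties using (any?; punchOut-injective; injective⇒≤)
open import Data.Rational using (ℚ; _-_; _≤_; _<_; _⊓_; _⊔_)
open import Data.Rational.Properties
  using ( ≤-trans; ≤-total; ≤-decTotalOrder; _≤?_; <⇒≤; ≰⇒>; ≮⇒≥
        ; <-irrefl; <-≤-trans; ≤-<-trans
        ; +-monoʳ-≤; +-monoʳ-<; neg-antimono-≤; neg-antimono-<
        ; antimono-≤-distrib-⊓; antimono-≤-distrib-⊔; ⊓-comm; ⊔-comm; ⊓-glb; ⊔-lub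
        ; p⊓q≤q; p⊓q≤p⊔q; p≤p⊔q; p≤q⇒p⊓q≡p; p≥q⇒p⊓q≡q; p≤q⇒p⊔q≡q; p≥q⇒p⊔q≡p
        ; module ≤-Reasoning )
open import Data.List using (List; []; _∷_; length; lookup; tabulate; map; foldr)
open import Data.List.Properties using (map-tabulate; length-tabulate)
open import Data.List.Membership.Propositional.Properties using (∈-lookup)
open import Data.List.Relation.Unary.All as All using (All; []; _∷_)
open import Data.List.Relation.Unary.All.Properties using (tabulate⁺)
open import Data.List.Relation.Unary.Linked using ([]; [-]; _∷_)
open import Data.List.Relation.Unary.Sorted.TotalOrder.Properties using (↗↭↗⇒≋)
open import Data.List.Relation.Binary.Permutation.Propositional
  using (_↭_; prep; swap; ↭-refl; ↭-trans; ↭-sym; ↭⇒↭ₛ)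
open import Data.List.Relation.Binary.Pointwise using (Pointwise-≡⇒≡)
import Data.List.Sort as Sort
open import Data.Product using (_×_; _,_; proj₁; proj₂)
open import Data.Sum using (inj₁; inj₂)
open import Function using (_∘_)
open import Function.Definitions using (Injective; StrictlySurjective)
open import Level using (0ℓ)
open import Relation.Binary.Bundles using (DecTotalOrder; TotalOrder)
open import Relation.Binary.PropositionalEquality
  using (_≡_; _≢_; refl; sym; trans; cong; cong₂; subst; subst₂; module ≡-Reasoning)
open import Relation.Nullary using (¬_; yes; no; contradiction)
open import Relation.Nullary.Decidable using (decidable-stable)
open import Relation.Unary using (Pred; Decidable)

open Sort ≤-decTotalOrder using (sort; sort-↭; sort-↗)

<⇒≱ : ∀ {p q} → p < q → ¬ (q ≤ p)
<⇒≱ p<q q≤p = <-irrefl refl (<-≤-trans p<q q≤p)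

sub-antimonoʳ-≤ : ∀ v {p q} → p ≤ q → v - q ≤ v - p
sub-antimonoʳ-≤ v p≤q = +-monoʳ-≤ v (neg-antimono-≤ p≤q)

sub-antimonoʳ-< : ∀ v {p q} → p < q → v - q < v - p
sub-antimonoʳ-< v p<q = +-monoʳ-< v (neg-antimono-< p<q)

sub-cancelˡ-≤ : ∀ v {p q} → v - q ≤ v - p → p ≤ q
sub-cancelˡ-≤ v le = ≮⇒≥ (λ q<p → <⇒≱ (sub-antimonoʳ-< v q<p) le)

sub-cancelˡ-< : ∀ v {p q} → v - q < v - p → p < q
sub-cancelˡ-< v lt = ≰⇒> (λ q≤p → <⇒≱ lt (sub-antimonoʳ-≤ v q≤p))

injective⇒strictlySurjective : ∀ {n} {f : Fin n → Fin n} →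
  Injective _≡_ _≡_ f → StrictlySurjective _≡_ f
injective⇒strictlySurjective {suc n} {f} f-inj y with any? (λ x → f x ≟ y)
... | yes hit = hit
... | no miss = contradiction (injective⇒≤ avoid-y-injective) (ℕ.<-irrefl refl)
  where
  f≢y : ∀ x → y ≢ f x
  f≢y x y≡fx = miss (x , sym y≡fx)
  avoid-y-injective : Injective _≡_ _≡_ (λ x → punchOut (f≢y x))
  avoid-y-injective = f-inj ∘ punchOut-injective (f≢y _) (f≢y _)

module Splice {n} {P Q : Pred (Fin n) 0ℓ} (P? : Decidable P) {f g : Fin n → Fin n}
  (f-injective : Injective _≡_ _≡_ f) (g-injective : Injective _≡_ _≡_ g)
  (f-P⇒Q : ∀ {x} → P x → Q (f x)) (g-¬P⇒¬Q : ∀ {x} → ¬ P x → ¬ Q (g x)) where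

  splice : Fin n → Fin n
  splice x with P? x
  ... | yes _ = f x
  ... | no _  = g x

  splice-injective : Injective _≡_ _≡_ splice
  splice-injective {x} {y} eq with P? x | P? y
  ... | yes _  | yes _  = f-injective eq
  ... | no _   | no _   = g-injective eq
  ... | yes Px | no ¬Py = contradiction (subst Q eq (f-P⇒Q Px)) (g-¬P⇒¬Q ¬Py)
  ... | no ¬Px | yes Py = contradiction (subst Q (sym eq) (f-P⇒Q Py)) (g-¬P⇒¬Q ¬Px)

  f-¬P⇒¬Q : ∀ {x} → ¬ P x → ¬ Q (f x)
  f-¬P⇒¬Q {x} ¬Px Qfx with injective⇒strictlySurjective splice-injective (f x)
  ... | y , eq with P? y
  ...   | yes Py = ¬Px (subst P (f-injective eq) Py)
  ...   | no ¬Py = g-¬P⇒¬Q ¬Py (subst Q (sym eq) Qfx)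

  g-P⇒Q : Decidable Q → ∀ {x} → P x → Q (g x)
  g-P⇒Q Q? {x} Px = decidable-stable (Q? (g x)) ¬¬Qgx
    where
    ¬¬Qgx : ¬ ¬ Q (g x)
    ¬¬Qgx ¬Qgx with injective⇒strictlySurjective splice-injective (g x)
    ... | y , eq with P? y
    ...   | yes Py = ¬Qgx (subst Q eq (f-P⇒Q Py))
    ...   | no ¬Py = ¬Py (subst P (sym (g-injective eq)) Px)

meet join : ∀ {n} → PriceVector n → PriceVector n → PriceVector n
meet p q m = p m ⊓ q m
join p q m = p m ⊔ q m

module _ {n} (v : Valuation n) where

  Preferred-resp : ∀ {p q : PriceVector n} → (∀ m → p m ≡ q m) →
    ∀ {b i} → Preferred v p b i → Preferred v q b i
  Preferred-resp p≗q {b} {i} pref i′ =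
    subst₂ _≤_ (cong (v b i′ -_) (p≗q i′)) (cong (v b i -_) (p≗q i)) (pref i′)

  MarketClearing-resp : ∀ {p q : PriceVector n} → (∀ m → p m ≡ q m) →
    MarketClearing v p → MarketClearing v q
  MarketClearing-resp p≗q (σ , σ-injective , σ-preferred) =
    σ , σ-injective , λ b → Preferred-resp p≗q (σ-preferred b)

  payoff-meet : ∀ p q b i → payoff v (meet p q) b i ≡ payoff v p b i ⊔ payoff v q b i
  payoff-meet p q b i = antimono-≤-distrib-⊓ (sub-antimonoʳ-≤ (v b i)) (p i) (q i)

  payoff-join : ∀ p q b i → payoff v (join p q) b i ≡ payoff v p b i ⊓ payoff v q b i
  payoff-join p q b i = antimono-≤-distrib-⊔ (sub-antimonoʳ-≤ (v b i)) (p i) (q i)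

  meet-preferred : ∀ {p q b i} → Preferred v p b i →
    (∀ i′ → payoff v q b i′ ≤ payoff v p b i) → Preferred v (meet p q) b i
  meet-preferred {p} {q} {b} {i} pref q-below i′ = begin
    payoff v (meet p q) b i′               ≡⟨ payoff-meet p q b i′ ⟩
    payoff v p b i′ ⊔ payoff v q b i′      ≤⟨ ⊔-lub (pref i′) (q-below i′) ⟩
    payoff v p b i                         ≤⟨ p≤p⊔q (payoff v p b i) (payoff v q b i) ⟩
    payoff v p b i ⊔ payoff v q b i        ≡⟨ payoff-meet p q b i ⟨
    payoff v (meet p q) b i                ∎
    where open ≤-Reasoning

  join-preferred : ∀ {p q b i} → Preferred v q b i → p i ≤ q i → Preferred v (join p q) b i
  join-preferred {p} {q} {b} {i} pref pi≤qi i′ = begin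
    payoff v (join p q) b i′               ≡⟨ payoff-join p q b i′ ⟩
    payoff v p b i′ ⊓ payoff v q b i′      ≤⟨ p⊓q≤q (payoff v p b i′) (payoff v q b i′) ⟩
    payoff v q b i′                        ≤⟨ pref i′ ⟩
    payoff v q b i                         ≡⟨ p≥q⇒p⊓q≡q (sub-antimonoʳ-≤ (v b i) pi≤qi) ⟨
    payoff v p b i ⊓ payoff v q b i        ≡⟨ payoff-join p q b i ⟨
    payoff v (join p q) b i                ∎
    where open ≤-Reasoning

  preferred⇒cheaper : ∀ {p q b i j} → Preferred v p b i → Preferred v q b j →
    payoff v q b j ≤ payoff v p b i → p i ≤ q i
  preferred⇒cheaper {b = b} {i} pref-p pref-q le =
    sub-cancelˡ-≤ (v b i) (≤-trans (pref-q i) le)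

  preferred⇒strictly-cheaper : ∀ {p q b i j} → Preferred v p b i → Preferred v q b j →
    payoff v p b i < payoff v q b j → q j < p j
  preferred⇒strictly-cheaper {b = b} {j = j} pref-p pref-q lt =
    sub-cancelˡ-< (v b j) (≤-<-trans (pref-p j) lt)

  meet-join-clearing : ∀ {p q} → MarketClearing v p → MarketClearing v q →
    MarketClearing v (meet p q) × MarketClearing v (join p q)
  meet-join-clearing {p} {q} (σ , σ-injective , σ-preferred) (τ , τ-injective , τ-preferred) =
      (Meet.splice , Meet.splice-injective , meet-matching-preferred)
    , (Join.splice , Join.splice-injective , join-matching-preferred)
    where
    p-pays-more : Pred (Fin n) 0ℓ
    p-pays-more b = payoff v q b (τ b) ≤ payoff v p b (σ b)

    p-pays-more? : Decidable p-pays-more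
    p-pays-more? b = payoff v q b (τ b) ≤? payoff v p b (σ b)

    cheaper-under-p : Pred (Fin n) 0ℓ
    cheaper-under-p i = p i ≤ q i

    cheaper-under-p? : Decidable cheaper-under-p
    cheaper-under-p? i = p i ≤? q i

    module Meet = Splice {Q = cheaper-under-p} p-pays-more? σ-injective τ-injective
      (λ le → preferred⇒cheaper (σ-preferred _) (τ-preferred _) le)
      (λ ¬le → <⇒≱ (preferred⇒strictly-cheaper (σ-preferred _) (τ-preferred _) (≰⇒> ¬le)))

    module Join = Splice {Q = cheaper-under-p} p-pays-more? τ-injective σ-injective
      (Meet.g-P⇒Q cheaper-under-p?) Meet.f-¬P⇒¬Q

    meet-matching-preferred : ∀ b → Preferred v (meet p q) b (Meet.splice b)
    meet-matching-preferred b with p-pays-more? b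
    ... | yes le = meet-preferred (σ-preferred b) (λ i′ → ≤-trans (τ-preferred b i′) le)
    ... | no ¬le = Preferred-resp (λ m → ⊓-comm (q m) (p m))
      (meet-preferred (τ-preferred b) (λ i′ → ≤-trans (σ-preferred b i′) (<⇒≤ (≰⇒> ¬le))))

    join-matching-preferred : ∀ b → Preferred v (join p q) b (Join.splice b)
    join-matching-preferred b with p-pays-more? b
    ... | yes le = join-preferred {p = p} (τ-preferred b) (Meet.g-P⇒Q cheaper-under-p? le)
    ... | no ¬le = Preferred-resp (λ m → ⊔-comm (q m) (p m))
      (join-preferred {p = q} (σ-preferred b) (<⇒≤ (≰⇒> (Meet.f-¬P⇒¬Q ¬le))))

module MinMaxSort {A : Set} (_∧_ _∨_ : A → A → A) where

  insert : A → List A → List A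
  insert a []       = a ∷ []
  insert a (x ∷ xs) = a ∧ x ∷ insert (a ∨ x) xs

  sortWith : List A → List A
  sortWith = foldr insert []

  length-insert : ∀ a xs → length (insert a xs) ≡ suc (length xs)
  length-insert a []       = refl
  length-insert a (x ∷ xs) = cong suc (length-insert (a ∨ x) xs)

  length-sortWith : ∀ xs → length (sortWith xs) ≡ length xs
  length-sortWith []       = refl
  length-sortWith (a ∷ as) = trans (length-insert a (sortWith as)) (cong suc (length-sortWith as))

  module _ {P : A → Set} (P-∧ : ∀ {a b} → P a → P b → P (a ∧ b))
    (P-∨ : ∀ {a b} → P a → P b → P (a ∨ b)) where

    All-insert : ∀ {a xs} → P a → All P xs → All P (insert a xs)
    All-insert Pa []         = Pa ∷ []
    All-insert Pa (Px ∷ Pxs) = P-∧ Pa Px ∷ All-insert (P-∨ Pa Px) Pxs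

    All-sortWith : ∀ {xs} → All P xs → All P (sortWith xs)
    All-sortWith []         = []
    All-sortWith (Pa ∷ Pas) = All-insert Pa (All-sortWith Pas)

module _ {A B : Set} {_∧_ _∨_ : A → A → A} {_∧′_ _∨′_ : B → B → B} (h : A → B)
  (h-∧ : ∀ a b → h (a ∧ b) ≡ h a ∧′ h b) (h-∨ : ∀ a b → h (a ∨ b) ≡ h a ∨′ h b) where

  private
    module S  = MinMaxSort _∧_ _∨_
    module S′ = MinMaxSort _∧′_ _∨′_

  map-insert : ∀ a xs → map h (S.insert a xs) ≡ S′.insert (h a) (map h xs)
  map-insert a []       = refl
  map-insert a (x ∷ xs) =
    cong₂ _∷_ (h-∧ a x) (trans (map-insert (a ∨ x) xs) (cong (λ c → S′.insert c (map h xs)) (h-∨ a x)))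

  map-sortWith : ∀ xs → map h (S.sortWith xs) ≡ S′.sortWith (map h xs)
  map-sortWith []       = refl
  map-sortWith (a ∷ as) =
    trans (map-insert a (S.sortWith as)) (cong (S′.insert (h a)) (map-sortWith as))

≤-totalOrder : TotalOrder 0ℓ 0ℓ 0ℓ
≤-totalOrder = DecTotalOrder.totalOrder ≤-decTotalOrder

open import Data.List.Relation.Unary.Sorted.TotalOrder ≤-totalOrder using (Sorted)
open MinMaxSort _⊓_ _⊔_ using () renaming (insert to insertℚ; sortWith to sortℚ)

insertℚ-sorted : ∀ a {xs} → Sorted xs → Sorted (insertℚ a xs)
insertℚ-sorted a []                 = [-]
insertℚ-sorted a {x ∷ []} [-]        = p⊓q≤p⊔q a x ∷ [-]
insertℚ-sorted a {x ∷ y ∷ ys} (x≤y ∷ s) =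
  ⊓-glb (p⊓q≤p⊔q a x) (≤-trans (p⊓q≤q a x) x≤y) ∷ insertℚ-sorted (a ⊔ x) s

sortℚ-sorted : ∀ xs → Sorted (sortℚ xs)
sortℚ-sorted []       = []
sortℚ-sorted (a ∷ as) = insertℚ-sorted a (sortℚ-sorted as)

insertℚ-↭ : ∀ a xs → insertℚ a xs ↭ a ∷ xs
insertℚ-↭ a []       = ↭-refl
insertℚ-↭ a (x ∷ xs) with ≤-total a x
... | inj₁ a≤x rewrite p≤q⇒p⊓q≡p a≤x | p≤q⇒p⊔q≡q a≤x = prep a (insertℚ-↭ x xs)
... | inj₂ x≤a rewrite p≥q⇒p⊓q≡q x≤a | p≥q⇒p⊔q≡p x≤a =
  ↭-trans (prep x (insertℚ-↭ a xs)) (swap x a ↭-refl)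

sortℚ-↭ : ∀ xs → sortℚ xs ↭ xs
sortℚ-↭ []       = ↭-refl
sortℚ-↭ (a ∷ as) = ↭-trans (insertℚ-↭ a (sortℚ as)) (prep a (sortℚ-↭ as))

sort≡sortℚ : ∀ xs → sort xs ≡ sortℚ xs
sort≡sortℚ xs = Pointwise-≡⇒≡
  (↗↭↗⇒≋ ≤-totalOrder (sort-↗ xs) (sortℚ-sorted xs)
    (↭⇒↭ₛ (↭-trans (sort-↭ xs) (↭-sym (sortℚ-↭ xs)))))

sortPrices : ∀ {n} → List (PriceVector n) → List (PriceVector n)
sortPrices = MinMaxSort.sortWith meet join

sortPrices-clearing : ∀ {n} (v : Valuation n) {ps} →
  All (MarketClearing v) ps → All (MarketClearing v) (sortPrices ps)
sortPrices-clearing v = MinMaxSort.All-sortWith meet join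
  (λ cp cq → proj₁ (meet-join-clearing v cp cq)) (λ cp cq → proj₂ (meet-join-clearing v cp cq))

sort-coordinate : ∀ {n k} (M : Fin k → PriceVector n) m →
  sort (tabulate (λ i → M i m)) ≡ map (λ p → p m) (sortPrices (tabulate M))
sort-coordinate M m = begin
  sort (tabulate (λ i → M i m))                ≡⟨ sort≡sortℚ (tabulate (λ i → M i m)) ⟩
  sortℚ (tabulate (λ i → M i m))               ≡⟨ cong sortℚ (map-tabulate M (λ p → p m)) ⟨
  sortℚ (map (λ p → p m) (tabulate M))         ≡⟨ map-sortWith (λ p → p m) (λ _ _ → refl) (λ _ _ → refl) (tabulate M) ⟨
  map (λ p → p m) (sortPrices (tabulate M))    ∎
  where open ≡-Reasoning

lookup-cast-map : ∀ {A B : Set} (f : A → B) {xs ys} → ys ≡ map f xs →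
  ∀ {k} (c : k ≡ length ys) (c′ : k ≡ length xs) j → lookup ys (cast c j) ≡ f (lookup xs (cast c′ j))
lookup-cast-map f {[]}     refl refl c′ ()
lookup-cast-map f {x ∷ xs} refl c    c′ zero    = refl
lookup-cast-map f {x ∷ xs} refl c    c′ (suc j) =
  lookup-cast-map f {xs} refl (ℕ.suc-injective c) (ℕ.suc-injective c′) j

corollary2 : (n k : ℕ) (v : Valuation n) (M : Fin k → PriceVector n)
    → (∀ i i′ → (∀ m → M i m ≡ M i′ m) → i ≡ i′)
    → (∀ i → MarketClearing v (M i))
    → ∀ j → MarketClearing v (pj M j)
corollary2 n k v M _ M-clearing j =
  MarketClearing-resp v (λ m → sym (pj≡jth m)) (All.lookup sorted-clearing (∈-lookup (cast k≡len j)))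
  where
  sorted : List (PriceVector n)
  sorted = sortPrices (tabulate M)

  sorted-clearing : All (MarketClearing v) sorted
  sorted-clearing = sortPrices-clearing v (tabulate⁺ M-clearing)

  k≡len : k ≡ length sorted
  k≡len = sym (trans (MinMaxSort.length-sortWith meet join (tabulate M)) (length-tabulate M))

  pj≡jth : ∀ m → pj M j m ≡ lookup sorted (cast k≡len j) m
  pj≡jth m = lookup-cast-map (λ p → p m) (sort-coordinate M m)
    (sym (sorted-length (λ i → M i m))) k≡len j
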